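{- For a finite simple graph $G$ on $n$ vertices, $\theta(G)=D(G)$ if and only if $G$ is asymmetric, or $G$ is the complete graph $K_n$, or $G$ is the empty graph $\overline{K_n}$.
   Context: A graph is asymmetric if its automorphism group is trivial. A vertex coloring is distinguishing if no non-identity automorphism preserves it. $D(G)$ is the minimum number of colors of a distinguishing coloring of $G$; $\theta(G)$ is the minimum $k$ such that every vertex coloring of $G$ using $k$ colors is distinguishing. -}

module Defs where

open import Data.Nat using (ℕ; _≤_)
open import Data.Fin using (Fin)
open import Data.Fin.Permutation using (Permutation′; _⟨$⟩ʳ_)
open import Data.Bool using (Bool; true; false)
open import Data.Product using (_×_; Σ)
open import Function.Definitions using (Surjective)
open import Relation.Binary.PropositionalEquality using (_≡_)
open import Relation.Nullary using (¬_)

record Graph (n : ℕ) : Set where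
  field
    adj    : Fin n → Fin n → Bool
    sym    : ∀ i j → adj i j ≡ adj j i
    irrefl : ∀ i → adj i i ≡ false
open Graph public

IsAutomorphism : ∀ {n} → Graph n → Permutation′ n → Set
IsAutomorphism G σ = ∀ i j → adj G (σ ⟨$⟩ʳ i) (σ ⟨$⟩ʳ j) ≡ adj G i j

IsIdentity : ∀ {n} → Permutation′ n → Set
IsIdentity σ = ∀ i → σ ⟨$⟩ʳ i ≡ i

Asymmetric : ∀ {n} → Graph n → Set
Asymmetric G = ∀ σ → IsAutomorphism G σ → IsIdentity σ

IsComplete : ∀ {n} → Graph n → Set
IsComplete G = ∀ i j → ¬ (i ≡ j) → adj G i j ≡ true

IsEmptyGraph : ∀ {n} → Graph n → Set
IsEmptyGraph G = ∀ i j → adj G i j ≡ false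

Distinguishing : ∀ {n k} → Graph n → (Fin n → Fin k) → Set
Distinguishing G c =
  ∀ σ → IsAutomorphism G σ → (∀ i → c (σ ⟨$⟩ʳ i) ≡ c i) → IsIdentity σ

HasDistinguishingColoring : ∀ {n} → Graph n → ℕ → Set
HasDistinguishingColoring {n} G k = Σ (Fin n → Fin k) (Distinguishing G)

EveryColoringDistinguishing : ∀ {n} → Graph n → ℕ → Set
EveryColoringDistinguishing {n} G k =
  (c : Fin n → Fin k) → Surjective _≡_ _≡_ c → Distinguishing G c

IsLeastPositive : (ℕ → Set) → ℕ → Set
IsLeastPositive P m = (1 ≤ m × P m) × (∀ k → 1 ≤ k → P k → m ≤ k)

IsDistinguishingNumber : ∀ {n} → Graph n → ℕ → Set
IsDistinguishingNumber G = IsLeastPositive (HasDistinguishingColoring G)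

IsDistinguishingThreshold : ∀ {n} → Graph n → ℕ → Set
IsDistinguishingThreshold G = IsLeastPositive (EveryColoringDistinguishing G)

{-# OPTIONS --safe #-}
-- If G is asymmetric, both parameters are 1. In K_n and its complement every permutation
-- is an automorphism, so a coloring is distinguishing exactly when it is injective, and
-- both parameters equal n (or 1 when n = 0).
--
-- Conversely let θ = D. If θ = 1, the constant coloring is distinguishing, so G is
-- asymmetric. If θ = m + 2 and some vertex z is adjacent to exactly one of x and y, we
-- build a distinguishing (m + 1)-coloring, contradicting D = m + 2. For m ≥ 1, color z
-- alone and x, y alike; splitting the class of x and y by adjacency to z gives a
-- surjective (m + 2)-coloring, which is distinguishing, and an automorphism preserving the
-- coarse coloring fixes z and hence preserves the fine one. For m = 0 every surjective
-- two-coloring is distinguishing, so a non-trivial automorphism σ leaves no proper subset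
-- invariant: it is one cycle v, σ v, σ² v, … through all vertices. Then σⁱ v ↦ σ⁻ⁱ v is an
-- automorphism leaving {v} invariant, hence the identity, which forces σ² v = v and n ≤ 2.
-- So every vertex sees all other vertices alike, and G is complete or empty.
module Submission where

open import Defs renaming (sym to adj-sym; irrefl to adj-irrefl)
open import Data.Bool using (Bool; true; if_then_else_)
import Data.Bool.Properties as Bool
open import Data.Empty using (⊥; ⊥-elim)
open import Data.Fin using (Fin; zero; suc; toℕ; inject≤; punchIn; punchOut; pinch)
open import Data.Fin.Permutation
  using (Permutation′; _⟨$⟩ʳ_; _⟨$⟩ˡ_; permutation; inverseˡ; transpose)
open import Data.Fin.Properties
  using (_≟_; any?; inject≤-injective; injective⇒≤; pigeonhole; pinch-surjective;
         punchOut-injective; punchOut-cong; punchOut-punchIn; punchInᵢ≢i)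
open import Data.Nat using (ℕ; zero; suc; _+_; _∸_; _≤_; _<_; _≤′_; ≤′-refl; ≤′-step; z≤n; s≤s)
open import Data.Nat.Properties
  using (≤-refl; ≤-reflexive; ≤-antisym; <⇒≤; <⇒≱; ≰⇒>; _≤?_; ≤⇒≤′; +-comm; m+[n∸m]≡n; m∸[m∸n]≡n;
         m<n⇒0<n∸m; m∸n≤m; 1+n≰n; anyUpTo?; _<?_; ≮⇒≥)
open import Data.Product using (Σ; ∃; _×_; _,_; proj₁; proj₂)
open import Data.Sum using (_⊎_; inj₁; inj₂)
import Data.Sum as Sum
open import Function using (id; _∘_)
open import Function.Bundles using (_⇔_; mk⇔)
import Function.Construct.Composition as Compose
open import Function.Definitions using (Injective; Surjective)
open import Relation.Binary.PropositionalEquality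
open import Relation.Nullary using (¬_; yes; no; contradiction)
open import Relation.Nullary.Decidable using (does; dec-true; dec-false; does-⇔)
open import Relation.Unary using (Pred; Decidable)
open import Level using (0ℓ)

private
  variable
    n k : ℕ

-- Colorings with at least as many colors as vertices

injective⇒distinguishing : (G : Graph n) {c : Fin n → Fin k} →
  Injective _≡_ _≡_ c → Distinguishing G c
injective⇒distinguishing G c-inj σ _ c-pres i = c-inj (c-pres i)

hasDistinguishingColoring-≥ : (G : Graph n) → n ≤ k → HasDistinguishingColoring G k
hasDistinguishingColoring-≥ G n≤k =
  (λ i → inject≤ i n≤k) , injective⇒distinguishing G (inject≤-injective n≤k n≤k _ _)

injective-missing⇒< : ∀ {m} {f : Fin m → Fin n} → Injective _≡_ _≡_ f →
  (w : Fin n) → (∀ y → f y ≢ w) → m < n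
injective-missing⇒< {n = suc n} {f = f} f-inj w w∉f =
  s≤s (injective⇒≤ {f = λ y → punchOut (w∉f y ∘ sym)}
                   (λ {a} {b} e → f-inj (punchOut-injective (w∉f a ∘ sym) (w∉f b ∘ sym) e)))

-- A section of c is an injection Fin k → Fin n missing u or v, so k < n.
surjective⇒injective : {c : Fin n → Fin k} → n ≤ k →
  Surjective _≡_ _≡_ c → Injective _≡_ _≡_ c
surjective⇒injective {n = n} {k = k} {c = c} n≤k c-surj {u} {v} cu≡cv with u ≟ v
... | yes u≡v = u≡v
... | no u≢v = contradiction n≤k (<⇒≱ (injective-missing⇒< s-injective w w∉s))
  where
  s : Fin k → Fin n
  s y = proj₁ (c-surj y)
  c∘s : ∀ y → c (s y) ≡ y
  c∘s y = proj₂ (c-surj y) refl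
  s-injective : Injective _≡_ _≡_ s
  s-injective {a} {b} e = trans (sym (c∘s a)) (trans (cong c e) (c∘s b))
  s≡⇒≡c : ∀ {y w} → s y ≡ w → y ≡ c w
  s≡⇒≡c {y} e = trans (sym (c∘s y)) (cong c e)
  missed : Σ (Fin n) λ w → ∀ y → s y ≢ w
  missed with s (c u) ≟ u
  ... | yes s[cu]≡u = v , λ y sy≡v →
    u≢v (trans (sym s[cu]≡u) (trans (cong s (sym (trans (s≡⇒≡c sy≡v) (sym cu≡cv)))) sy≡v))
  ... | no s[cu]≢u = u , λ y sy≡u → s[cu]≢u (trans (cong s (sym (s≡⇒≡c sy≡u))) sy≡u)
  w = proj₁ missed
  w∉s = proj₂ missed

everyColoringDistinguishing-≥ : (G : Graph n) → n ≤ k → EveryColoringDistinguishing G k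
everyColoringDistinguishing-≥ G n≤k c c-surj =
  injective⇒distinguishing G (surjective⇒injective n≤k c-surj)

collapse : ∀ {m} → m ≤′ n → Fin (suc n) → Fin (suc m)
collapse ≤′-refl = id
collapse (≤′-step m≤n) = collapse m≤n ∘ pinch zero

collapse-surjective : ∀ {m} (m≤n : m ≤′ n) → Surjective _≡_ _≡_ (collapse m≤n)
collapse-surjective ≤′-refl y = y , id
collapse-surjective (≤′-step m≤n) =
  Compose.surjective _≡_ _≡_ _≡_ (pinch-surjective zero) (collapse-surjective m≤n)

surjection : 1 ≤ k → k ≤ n → Σ (Fin n → Fin k) (Surjective _≡_ _≡_)
surjection {suc k} {suc n} _ (s≤s k≤n) = collapse (≤⇒≤′ k≤n) , collapse-surjective (≤⇒≤′ k≤n)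

-- Complete and empty graphs

FullySymmetric : Graph n → Set
FullySymmetric G = ∀ σ → IsAutomorphism G σ

⟨$⟩ʳ-injective : (σ : Permutation′ n) → Injective _≡_ _≡_ (σ ⟨$⟩ʳ_)
⟨$⟩ʳ-injective σ e = trans (sym (inverseˡ σ)) (trans (cong (σ ⟨$⟩ˡ_) e) (inverseˡ σ))

complete⇒fullySymmetric : (G : Graph n) → IsComplete G → FullySymmetric G
complete⇒fullySymmetric G complete σ i j with i ≟ j
... | yes refl = trans (adj-irrefl G _) (sym (adj-irrefl G i))
... | no i≢j = trans (complete _ _ (i≢j ∘ ⟨$⟩ʳ-injective σ)) (sym (complete i j i≢j))

empty⇒fullySymmetric : (G : Graph n) → IsEmptyGraph G → FullySymmetric G
empty⇒fullySymmetric G empty σ i j = trans (empty _ _) (sym (empty i j))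

transpose-moves : (u v : Fin n) → transpose u v ⟨$⟩ʳ u ≡ v
transpose-moves u v with u ≟ u
... | yes _ = refl
... | no u≢u = contradiction refl u≢u

transpose-preserves : {c : Fin n → Fin k} {u v : Fin n} → c u ≡ c v →
  ∀ w → c (transpose u v ⟨$⟩ʳ w) ≡ c w
transpose-preserves {u = u} {v} cu≡cv w with w ≟ u
... | yes refl = sym cu≡cv
... | no _ with w ≟ v
...   | yes refl = cu≡cv
...   | no _ = refl

fullySymmetric-distinguishing⇒injective : (G : Graph n) → FullySymmetric G →
  {c : Fin n → Fin k} → Distinguishing G c → Injective _≡_ _≡_ c
fullySymmetric-distinguishing⇒injective G symmetric {c} c-dist {u} {v} cu≡cv =
  sym (trans (sym (transpose-moves u v)) (c-dist τ (symmetric τ) (transpose-preserves cu≡cv) u))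
  where τ = transpose u v

module _ (G : Graph n) (symmetric : FullySymmetric G) where

  hasDistinguishingColoring⇒≤ : HasDistinguishingColoring G k → n ≤ k
  hasDistinguishingColoring⇒≤ (c , c-dist) =
    injective⇒≤ (fullySymmetric-distinguishing⇒injective G symmetric c-dist)

  everyColoringDistinguishing⇒≤ : 1 ≤ k → EveryColoringDistinguishing G k → n ≤ k
  everyColoringDistinguishing⇒≤ {k} 1≤k every with k ≤? n
  ... | no k≰n = <⇒≤ (≰⇒> k≰n)
  ... | yes k≤n = let c , c-surj = surjection 1≤k k≤n in
    injective⇒≤ (fullySymmetric-distinguishing⇒injective G symmetric (every c c-surj))

_^_ : Permutation′ n → ℕ → Fin n → Fin n
(σ ^ zero) u = u
(σ ^ suc i) u = σ ⟨$⟩ʳ (σ ^ i) u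

module _ (σ : Permutation′ n) where

  ^-+ : ∀ i j u → (σ ^ (i + j)) u ≡ (σ ^ i) ((σ ^ j) u)
  ^-+ zero j u = refl
  ^-+ (suc i) j u = cong (σ ⟨$⟩ʳ_) (^-+ i j u)

  ^-comm : ∀ i j u → (σ ^ i) ((σ ^ j) u) ≡ (σ ^ j) ((σ ^ i) u)
  ^-comm i j u = trans (sym (^-+ i j u)) (trans (cong (λ m → (σ ^ m) u) (+-comm i j)) (^-+ j i u))

  ^-injective : ∀ i → Injective _≡_ _≡_ (σ ^ i)
  ^-injective zero e = e
  ^-injective (suc i) e = ^-injective i (⟨$⟩ʳ-injective σ e)

  ^-automorphism : (G : Graph n) → IsAutomorphism G σ →
    ∀ i u w → adj G ((σ ^ i) u) ((σ ^ i) w) ≡ adj G u w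
  ^-automorphism G σ-aut zero u w = refl
  ^-automorphism G σ-aut (suc i) u w = trans (σ-aut _ _) (^-automorphism G σ-aut i u w)

  ^-period : ∀ v → ∃ λ p → 1 ≤ p × (σ ^ p) v ≡ v
  ^-period v with pigeonhole ≤-refl (λ (i : Fin (suc n)) → (σ ^ toℕ i) v)
  ... | i , j , i<j , σⁱv≡σʲv = _ , m<n⇒0<n∸m i<j , sym (^-injective (toℕ i) (begin
      (σ ^ toℕ i) v                         ≡⟨ σⁱv≡σʲv ⟩
      (σ ^ toℕ j) v                         ≡⟨ cong (λ m → (σ ^ m) v) (sym (m+[n∸m]≡n (<⇒≤ i<j))) ⟩
      (σ ^ (toℕ i + (toℕ j ∸ toℕ i))) v     ≡⟨ ^-+ (toℕ i) _ v ⟩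
      (σ ^ toℕ i) ((σ ^ (toℕ j ∸ toℕ i)) v) ∎))
    where open ≡-Reasoning

  ^-twoCycle : ∀ {v} → σ ⟨$⟩ʳ (σ ⟨$⟩ʳ v) ≡ v → ∀ i → (σ ^ i) v ≡ v ⊎ (σ ^ i) v ≡ σ ⟨$⟩ʳ v
  ^-twoCycle σσv≡v zero = inj₁ refl
  ^-twoCycle σσv≡v (suc i) with ^-twoCycle σσv≡v i
  ... | inj₁ σⁱv≡v = inj₂ (cong (σ ⟨$⟩ʳ_) σⁱv≡v)
  ... | inj₂ σⁱv≡σv = inj₁ (trans (cong (σ ⟨$⟩ʳ_) σⁱv≡σv) σσv≡v)

pair-has-no-three-distinct : ∀ {a b x y z : Fin n} → (∀ u → u ≡ a ⊎ u ≡ b) →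
  x ≢ y → z ≢ x → z ≢ y → ⊥
pair-has-no-three-distinct {x = x} {y} {z} pair x≢y z≢x z≢y
  with pair x | pair y | pair z
... | inj₁ refl | inj₁ refl | _         = x≢y refl
... | inj₂ refl | inj₂ refl | _         = x≢y refl
... | inj₁ refl | _         | inj₁ refl = z≢x refl
... | inj₂ refl | _         | inj₂ refl = z≢x refl
... | _         | inj₁ refl | inj₁ refl = z≢y refl
... | _         | inj₂ refl | inj₂ refl = z≢y refl

module Orbit (σ : Permutation′ n) (v : Fin n) {p : ℕ} (1≤p : 1 ≤ p) (σᵖv≡v : (σ ^ p) v ≡ v) where

  1+[p∸1]≡p : 1 + (p ∸ 1) ≡ p
  1+[p∸1]≡p = m+[n∸m]≡n 1≤p

  σ[σᵖ⁻¹v]≡v : σ ⟨$⟩ʳ (σ ^ (p ∸ 1)) v ≡ v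
  σ[σᵖ⁻¹v]≡v = trans (cong (λ m → (σ ^ m) v) 1+[p∸1]≡p) σᵖv≡v

  InOrbit : Pred (Fin n) 0ℓ
  InOrbit u = ∃ λ i → i < p × (σ ^ i) v ≡ u

  v∈orbit : InOrbit v
  v∈orbit = 0 , 1≤p , refl

  inOrbit? : Decidable InOrbit
  inOrbit? u = anyUpTo? (λ i → (σ ^ i) v ≟ u) p

  inOrbit-σ : ∀ u → InOrbit (σ ⟨$⟩ʳ u) ⇔ InOrbit u
  inOrbit-σ u = mk⇔ backward forward
    where
    forward : InOrbit u → InOrbit (σ ⟨$⟩ʳ u)
    forward (i , i<p , σⁱv≡u) with suc i <? p
    ... | yes i+1<p = suc i , i+1<p , cong (σ ⟨$⟩ʳ_) σⁱv≡u
    ... | no i+1≮p = 0 , 1≤p , (begin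
      v                       ≡⟨ sym σᵖv≡v ⟩
      (σ ^ p) v               ≡⟨ cong (λ m → (σ ^ m) v) (≤-antisym (≮⇒≥ i+1≮p) i<p) ⟩
      σ ⟨$⟩ʳ (σ ^ i) v        ≡⟨ cong (σ ⟨$⟩ʳ_) σⁱv≡u ⟩
      σ ⟨$⟩ʳ u                ∎)
      where open ≡-Reasoning
    backward : InOrbit (σ ⟨$⟩ʳ u) → InOrbit u
    backward (suc i , i+1<p , σⁱ⁺¹v≡σu) = i , <⇒≤ i+1<p , ⟨$⟩ʳ-injective σ σⁱ⁺¹v≡σu
    backward (zero , _ , v≡σu) =
      p ∸ 1 , ≤-reflexive 1+[p∸1]≡p , ⟨$⟩ʳ-injective σ (trans σ[σᵖ⁻¹v]≡v v≡σu)

  module Reflection (G : Graph n) (σ-aut : IsAutomorphism G σ) (full : ∀ u → InOrbit u) where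

    index : Fin n → ℕ
    index u = proj₁ (full u)

    index≤p : ∀ u → index u ≤ p
    index≤p u = <⇒≤ (proj₁ (proj₂ (full u)))

    σ^index : ∀ u → (σ ^ index u) v ≡ u
    σ^index u = proj₂ (proj₂ (full u))

    -- σⁱ v ↦ σ⁻ⁱ v, written with non-negative exponents as σ ^ p fixes v.
    reflect : Fin n → Fin n
    reflect u = (σ ^ (p ∸ index u)) v

    σ^[p∸i]σ^i : ∀ {i} → i ≤ p → (σ ^ (p ∸ i)) ((σ ^ i) v) ≡ v
    σ^[p∸i]σ^i {i} i≤p = begin
      (σ ^ (p ∸ i)) ((σ ^ i) v) ≡⟨ ^-comm σ (p ∸ i) i v ⟩
      (σ ^ i) ((σ ^ (p ∸ i)) v) ≡⟨ sym (^-+ σ i (p ∸ i) v) ⟩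
      (σ ^ (i + (p ∸ i))) v     ≡⟨ cong (λ m → (σ ^ m) v) (m+[n∸m]≡n i≤p) ⟩
      (σ ^ p) v                 ≡⟨ σᵖv≡v ⟩
      v                         ∎
      where open ≡-Reasoning

    σ^[p∸_]-cong : ∀ {i j} → i ≤ p → j ≤ p → (σ ^ i) v ≡ (σ ^ j) v →
      (σ ^ (p ∸ i)) v ≡ (σ ^ (p ∸ j)) v
    σ^[p∸_]-cong {i} {j} i≤p j≤p σⁱv≡σʲv = begin
      (σ ^ (p ∸ i)) v                           ≡⟨ cong (σ ^ (p ∸ i)) (sym (σ^[p∸i]σ^i j≤p)) ⟩
      (σ ^ (p ∸ i)) ((σ ^ (p ∸ j)) ((σ ^ j) v)) ≡⟨ cong (σ ^ (p ∸ i) ∘ σ ^ (p ∸ j)) (sym σⁱv≡σʲv) ⟩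
      (σ ^ (p ∸ i)) ((σ ^ (p ∸ j)) ((σ ^ i) v)) ≡⟨ ^-comm σ (p ∸ i) (p ∸ j) _ ⟩
      (σ ^ (p ∸ j)) ((σ ^ (p ∸ i)) ((σ ^ i) v)) ≡⟨ cong (σ ^ (p ∸ j)) (σ^[p∸i]σ^i i≤p) ⟩
      (σ ^ (p ∸ j)) v                           ∎
      where open ≡-Reasoning

    reflect-σ^ : ∀ {i} → i ≤ p → reflect ((σ ^ i) v) ≡ (σ ^ (p ∸ i)) v
    reflect-σ^ i≤p = σ^[p∸_]-cong (index≤p _) i≤p (σ^index _)

    reflect-involutive : ∀ u → reflect (reflect u) ≡ u
    reflect-involutive u = begin
      reflect ((σ ^ (p ∸ index u)) v) ≡⟨ reflect-σ^ (m∸n≤m p (index u)) ⟩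
      (σ ^ (p ∸ (p ∸ index u))) v     ≡⟨ cong (λ m → (σ ^ m) v) (m∸[m∸n]≡n (index≤p u)) ⟩
      (σ ^ index u) v                 ≡⟨ σ^index u ⟩
      u                               ∎
      where open ≡-Reasoning

    reflect-v : reflect v ≡ v
    reflect-v = trans (reflect-σ^ {0} z≤n) σᵖv≡v

    reflect-σv : reflect (σ ⟨$⟩ʳ v) ≡ (σ ^ (p ∸ 1)) v
    reflect-σv = reflect-σ^ 1≤p

    σ^[i+j]∘reflect : ∀ {i} j → i ≤ p → (σ ^ (i + j)) ((σ ^ (p ∸ i)) v) ≡ (σ ^ j) v
    σ^[i+j]∘reflect {i} j i≤p = begin
      (σ ^ (i + j)) ((σ ^ (p ∸ i)) v)         ≡⟨ cong (λ m → (σ ^ m) ((σ ^ (p ∸ i)) v)) (+-comm i j) ⟩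
      (σ ^ (j + i)) ((σ ^ (p ∸ i)) v)         ≡⟨ ^-+ σ j i _ ⟩
      (σ ^ j) ((σ ^ i) ((σ ^ (p ∸ i)) v))     ≡⟨ cong (σ ^ j) (^-comm σ i (p ∸ i) v) ⟩
      (σ ^ j) ((σ ^ (p ∸ i)) ((σ ^ i) v))     ≡⟨ cong (σ ^ j) (σ^[p∸i]σ^i i≤p) ⟩
      (σ ^ j) v                               ∎
      where open ≡-Reasoning

    -- Rotating by index u + index w swaps reflect u and reflect w back to w and u.
    reflect-automorphism : ∀ u w → adj G (reflect u) (reflect w) ≡ adj G u w
    reflect-automorphism u w = begin
      adj G (reflect u) (reflect w)
        ≡⟨ ^-automorphism σ G σ-aut (i + j) _ _ ⟨
      adj G ((σ ^ (i + j)) (reflect u)) ((σ ^ (i + j)) (reflect w))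
        ≡⟨ cong₂ (adj G) σ^[i+j]reflect-u σ^[i+j]reflect-w ⟩
      adj G w u
        ≡⟨ adj-sym G w u ⟩
      adj G u w
        ∎
      where
      open ≡-Reasoning
      i = index u
      j = index w
      σ^[i+j]reflect-u : (σ ^ (i + j)) (reflect u) ≡ w
      σ^[i+j]reflect-u = trans (σ^[i+j]∘reflect j (index≤p u)) (σ^index w)
      σ^[i+j]reflect-w : (σ ^ (i + j)) (reflect w) ≡ u
      σ^[i+j]reflect-w = trans (cong (λ m → (σ ^ m) (reflect w)) (+-comm i j))
                               (trans (σ^[i+j]∘reflect i (index≤p w)) (σ^index u))

    reflection : Permutation′ n
    reflection = permutation reflect reflect reflect-involutive reflect-involutive

-- Graphs all of whose two-colorings are distinguishing

module _ (G : Graph n) (rigid : EveryColoringDistinguishing G 2) where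

  invariantSubset⇒identity : ∀ σ → IsAutomorphism G σ →
    {P : Pred (Fin n) 0ℓ} (P? : Decidable P) → (∀ u → P (σ ⟨$⟩ʳ u) ⇔ P u) →
    ∀ {a b} → P a → ¬ P b → IsIdentity σ
  invariantSubset⇒identity σ σ-aut P? P-invariant {a} {b} Pa ¬Pb =
    rigid c c-surjective σ σ-aut (λ u → cong toColor (does-⇔ (P-invariant u) (P? _) (P? u)))
    where
    toColor : Bool → Fin 2
    toColor b = if b then zero else suc zero
    c : Fin n → Fin 2
    c u = toColor (does (P? u))
    c-surjective : Surjective _≡_ _≡_ c
    c-surjective zero = a , λ { refl → cong toColor (dec-true (P? a) Pa) }
    c-surjective (suc zero) = b , λ { refl → cong toColor (dec-false (P? b) ¬Pb) }

  rigid₂⇒asymmetric : ∀ {x y z : Fin n} → x ≢ y → z ≢ x → z ≢ y → Asymmetric G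
  rigid₂⇒asymmetric x≢y z≢x z≢y σ σ-aut v with σ ⟨$⟩ʳ v ≟ v
  ... | yes σv≡v = σv≡v
  ... | no σv≢v = ⊥-elim (pair-has-no-three-distinct pair x≢y z≢x z≢y)
    where
    period = ^-period σ v
    p = proj₁ period
    open Orbit σ v (proj₁ (proj₂ period)) (proj₂ (proj₂ period))

    full : ∀ u → InOrbit u
    full u with inOrbit? u
    ... | yes inOrbit = inOrbit
    ... | no notInOrbit = contradiction
      (invariantSubset⇒identity σ σ-aut inOrbit? inOrbit-σ v∈orbit notInOrbit v)
      σv≢v

    open Reflection G σ-aut full

    reflection-identity : IsIdentity reflection
    reflection-identity = invariantSubset⇒identity reflection reflect-automorphism (_≟ v) fixes-v refl σv≢v
      where
      fixes-v : ∀ u → reflect u ≡ v ⇔ u ≡ v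
      fixes-v u = mk⇔ (λ ru≡v → trans (sym (reflect-involutive u)) (trans (cong reflect ru≡v) reflect-v))
                      (λ { refl → reflect-v })

    σσv≡v : σ ⟨$⟩ʳ (σ ⟨$⟩ʳ v) ≡ v
    σσv≡v = begin
      σ ⟨$⟩ʳ (σ ⟨$⟩ʳ v)           ≡⟨ cong (σ ⟨$⟩ʳ_) (reflection-identity (σ ⟨$⟩ʳ v)) ⟨
      σ ⟨$⟩ʳ reflect (σ ⟨$⟩ʳ v)   ≡⟨ cong (σ ⟨$⟩ʳ_) reflect-σv ⟩
      σ ⟨$⟩ʳ (σ ^ (p ∸ 1)) v      ≡⟨ σ[σᵖ⁻¹v]≡v ⟩
      v                           ∎
      where open ≡-Reasoning

    pair : ∀ u → u ≡ v ⊎ u ≡ σ ⟨$⟩ʳ v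
    pair u = let i , _ , σⁱv≡u = full u in
      Sum.map (trans (sym σⁱv≡u)) (trans (sym σⁱv≡u)) (^-twoCycle σ σσv≡v i)

-- Refining a coloring by adjacency to a vertex

module Refinement {s} (G : Graph n) (c : Fin n → Fin s) (z : Fin n) (a : Fin s) (b : Bool) where

  recolor : Fin s → Bool → Fin (suc s)
  recolor col b′ with col ≟ a | b′ Bool.≟ b
  ... | yes _ | no _ = zero
  ... | _     | _    = suc col

  recolor-split : ∀ {col b′} → col ≡ a → b′ ≢ b → recolor col b′ ≡ zero
  recolor-split {col} {b′} col≡a b′≢b with col ≟ a | b′ Bool.≟ b
  ... | yes _ | no _ = refl
  ... | no col≢a | _ = contradiction col≡a col≢a
  ... | yes _ | yes b′≡b = contradiction b′≡b b′≢b

  recolor-keep : ∀ {col b′} → col ≢ a ⊎ b′ ≡ b → recolor col b′ ≡ suc col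
  recolor-keep {col} {b′} keep with col ≟ a | b′ Bool.≟ b | keep
  ... | yes _ | yes _ | _ = refl
  ... | no _  | _     | _ = refl
  ... | yes col≡a | no _ | inj₁ col≢a = contradiction col≡a col≢a
  ... | yes _ | no b′≢b | inj₂ b′≡b = contradiction b′≡b b′≢b

  refine : Fin n → Fin (suc s)
  refine u = recolor (c u) (adj G z u)

  refine-distinguishing : (∀ u → c u ≡ c z → u ≡ z) → Distinguishing G refine → Distinguishing G c
  refine-distinguishing z-alone refine-dist σ σ-aut c-pres =
    refine-dist σ σ-aut (λ u → cong₂ recolor (c-pres u) (adj-z-pres u))
    where
    σz≡z : σ ⟨$⟩ʳ z ≡ z
    σz≡z = z-alone _ (c-pres z)
    adj-z-pres : ∀ u → adj G z (σ ⟨$⟩ʳ u) ≡ adj G z u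
    adj-z-pres u = trans (cong (λ w → adj G w (σ ⟨$⟩ʳ u)) (sym σz≡z)) (σ-aut z u)

  refine-surjective : Surjective _≡_ _≡_ c → ∀ {x y} → c x ≡ a → c y ≡ a →
    adj G z x ≡ b → adj G z y ≢ b → Surjective _≡_ _≡_ refine
  refine-surjective c-surj {x} {y} cx≡a cy≡a zx≡b zy≢b = surj
    where
    surj : Surjective _≡_ _≡_ refine
    surj zero = y , λ { refl → recolor-split cy≡a zy≢b }
    surj (suc col) with col ≟ a
    ... | yes refl = x , λ { refl → trans (recolor-keep (inj₂ zx≡b)) (cong suc cx≡a) }
    ... | no col≢a =
      u , λ { refl → trans (recolor-keep (inj₁ (col≢a ∘ trans (sym cu≡col)))) (cong suc cu≡col) }
      where
      u = proj₁ (c-surj col)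
      cu≡col = proj₂ (c-surj col) refl

insertAt : {A : Set} → Fin (suc n) → A → (Fin n → A) → Fin (suc n) → A
insertAt i a f j with i ≟ j
... | yes _ = a
... | no i≢j = f (punchOut i≢j)

module _ {A : Set} (i : Fin (suc n)) {a : A} {f : Fin n → A} where

  insertAt-≡ : insertAt i a f i ≡ a
  insertAt-≡ with i ≟ i
  ... | yes _ = refl
  ... | no i≢i = contradiction refl i≢i

  insertAt-≢ : ∀ {j} → (i≢j : i ≢ j) → insertAt i a f j ≡ f (punchOut i≢j)
  insertAt-≢ {j} i≢j with i ≟ j
  ... | yes i≡j = contradiction i≡j i≢j
  ... | no _ = cong f (punchOut-cong i refl)

  insertAt-unique : (∀ j → f j ≢ a) → ∀ j → insertAt i a f j ≡ a → j ≡ i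
  insertAt-unique a∉f j fj≡a with i ≟ j
  ... | yes i≡j = sym i≡j
  ... | no _ = contradiction fj≡a (a∉f _)

  insertAt-punchIn : ∀ j → insertAt i a f (punchIn i j) ≡ f j
  insertAt-punchIn j = trans (insertAt-≢ (punchInᵢ≢i i j ∘ sym)) (cong f (punchOut-punchIn i))

  insertAt-surjective : Surjective _≡_ _≡_ f → Surjective _≡_ _≡_ (insertAt i a f)
  insertAt-surjective f-surj y =
    punchIn i (proj₁ (f-surj y)) , λ { refl → trans (insertAt-punchIn _) (proj₂ (f-surj y) refl) }

isolatingColoring : suc (suc k) < n → {x y z : Fin n} → x ≢ y → z ≢ x → z ≢ y →
  Σ (Fin n → Fin (suc (suc k))) λ c →
    Surjective _≡_ _≡_ c × (∀ u → c u ≡ c z → u ≡ z) × c x ≡ c y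
isolatingColoring {k} {suc (suc n)} (s≤s (s≤s k<n)) {x} {y} {z} x≢y z≢x z≢y =
  c , c-surjective , z-alone , cx≡cy
  where
  x′ y′ : Fin (suc n)
  x′ = punchOut z≢x
  y′ = punchOut z≢y
  x′≢y′ : x′ ≢ y′
  x′≢y′ = x≢y ∘ punchOut-injective z≢x z≢y
  r = surjection {k = suc k} (s≤s z≤n) k<n
  q : Fin (suc n) → Fin (suc k)
  q = insertAt x′ (proj₁ r (punchOut x′≢y′)) (proj₁ r)
  c : Fin (suc (suc n)) → Fin (suc (suc k))
  c = insertAt z zero (suc ∘ q)
  c-surjective : Surjective _≡_ _≡_ c
  c-surjective zero = z , λ { refl → insertAt-≡ z }
  c-surjective (suc col) = punchIn z (proj₁ (q-surj col)) ,
    λ { refl → trans (insertAt-punchIn z _) (cong suc (proj₂ (q-surj col) refl)) }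
    where q-surj = insertAt-surjective x′ (proj₂ r)
  z-alone : ∀ u → c u ≡ c z → u ≡ z
  z-alone u cu≡cz = insertAt-unique z (λ _ ()) u (trans cu≡cz (insertAt-≡ z))
  cx≡cy : c x ≡ c y
  cx≡cy = begin
    c x                            ≡⟨ insertAt-≢ z z≢x ⟩
    suc (q x′)                     ≡⟨ cong suc (insertAt-≡ x′) ⟩
    suc (proj₁ r (punchOut x′≢y′)) ≡⟨ cong suc (insertAt-≢ x′ x′≢y′) ⟨
    suc (q y′)                     ≡⟨ insertAt-≢ z z≢y ⟨
    c y                            ∎
    where open ≡-Reasoning

smallerDistinguishingColoring : ∀ {m} (G : Graph n) → EveryColoringDistinguishing G (suc (suc m)) →
  ∀ {x y z} → x ≢ y → z ≢ x → z ≢ y → adj G z x ≢ adj G z y → HasDistinguishingColoring G (suc m)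
smallerDistinguishingColoring {m = zero} G rigid x≢y z≢x z≢y _ =
  (λ _ → zero) , λ σ σ-aut _ → rigid₂⇒asymmetric G rigid x≢y z≢x z≢y σ σ-aut
smallerDistinguishingColoring {n} {suc m} G rigid {x} {y} {z} x≢y z≢x z≢y zx≢zy with n ≤? suc (suc m)
... | yes n≤m+2 = hasDistinguishingColoring-≥ G n≤m+2
... | no n≰m+2 =
  let c , c-surj , z-alone , cx≡cy = isolatingColoring (≰⇒> n≰m+2) x≢y z≢x z≢y
      open Refinement G c z (c x) (adj G z x)
  in c , refine-distinguishing z-alone
           (rigid refine (refine-surjective c-surj refl (sym cx≡cy) refl (zx≢zy ∘ sym)))

-- Graphs in which every vertex sees all other vertices alike

module _ (G : Graph n) (sameRow : ∀ {x y z} → x ≢ y → z ≢ x → z ≢ y → adj G z x ≡ adj G z y) where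

  adj-row : ∀ {z x y} → z ≢ x → z ≢ y → adj G z x ≡ adj G z y
  adj-row {z} {x} {y} z≢x z≢y with x ≟ y
  ... | yes refl = refl
  ... | no x≢y = sameRow x≢y z≢x z≢y

  adj-constant : ∀ {a b c d} → a ≢ b → c ≢ d → adj G a b ≡ adj G c d
  adj-constant {a} {b} {c} {d} a≢b c≢d with b ≟ c
  ... | yes refl = trans (adj-sym G a b) (adj-row (a≢b ∘ sym) c≢d)
  ... | no b≢c = begin
    adj G a b ≡⟨ adj-sym G a b ⟩
    adj G b a ≡⟨ adj-row (a≢b ∘ sym) b≢c ⟩
    adj G b c ≡⟨ adj-sym G b c ⟩
    adj G c b ≡⟨ adj-row (b≢c ∘ sym) c≢d ⟩
    adj G c d ∎
    where open ≡-Reasoning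

  complete⊎empty : IsComplete G ⊎ IsEmptyGraph G
  complete⊎empty with any? (λ i → any? (λ j → adj G i j Bool.≟ true))
  ... | yes (i , j , ij) = inj₁ λ a b a≢b → trans (adj-constant a≢b i≢j) ij
    where i≢j : i ≢ j
          i≢j refl = contradiction (trans (sym ij) (adj-irrefl G i)) λ ()
  ... | no ¬edge = inj₂ λ i j → Bool.¬-not λ ij → ¬edge (i , j , ij)

-- The distinguishing number and threshold

least-≤ : ∀ {P : ℕ → Set} {m} → IsLeastPositive P m → 1 ≤ k → P k → m ≤ k
least-≤ ((_ , _) , minimal) = minimal _

least≡1 : ∀ {P : ℕ → Set} {m} → IsLeastPositive P m → P 1 → m ≡ 1
least≡1 least P1 = ≤-antisym (least-≤ least ≤-refl P1) (proj₁ (proj₁ least))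

module _ (G : Graph n) {d t : ℕ}
         (D : IsDistinguishingNumber G d) (θ : IsDistinguishingThreshold G t) where

  asymmetric⇒θ≡D : Asymmetric G → t ≡ d
  asymmetric⇒θ≡D asym = trans (least≡1 θ (λ _ _ σ σ-aut _ → asym σ σ-aut))
                              (sym (least≡1 D ((λ _ → zero) , λ σ σ-aut _ → asym σ σ-aut)))

  fullySymmetric⇒θ≡D : FullySymmetric G → t ≡ d
  fullySymmetric⇒θ≡D symmetric = ≤-antisym
    (least-≤ θ 1≤d (everyColoringDistinguishing-≥ G n≤d))
    (least-≤ D 1≤t (hasDistinguishingColoring-≥ G n≤t))
    where
    1≤d = proj₁ (proj₁ D)
    1≤t = proj₁ (proj₁ θ)
    n≤d = hasDistinguishingColoring⇒≤ G symmetric (proj₂ (proj₁ D))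
    n≤t = everyColoringDistinguishing⇒≤ G symmetric 1≤t (proj₂ (proj₁ θ))

rigid₁⇒asymmetric : (G : Graph n) → EveryColoringDistinguishing G 1 → Asymmetric G
rigid₁⇒asymmetric G rigid σ σ-aut i =
  rigid (λ _ → zero) (λ { zero → i , λ _ → refl }) σ σ-aut (λ _ → refl) i

θ≡D⇒classified : (G : Graph n) {d t : ℕ} → IsDistinguishingNumber G d → IsDistinguishingThreshold G t →
  t ≡ d → Asymmetric G ⊎ IsComplete G ⊎ IsEmptyGraph G
θ≡D⇒classified G {t = suc zero} D ((_ , rigid) , _) _ = inj₁ (rigid₁⇒asymmetric G rigid)
θ≡D⇒classified G {t = suc (suc m)} D ((_ , rigid) , _) refl = inj₂ (complete⊎empty G sameRow)
  where
  sameRow : ∀ {x y z} → x ≢ y → z ≢ x → z ≢ y → adj G z x ≡ adj G z y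
  sameRow {x} {y} {z} x≢y z≢x z≢y with adj G z x Bool.≟ adj G z y
  ... | yes zx≡zy = zx≡zy
  ... | no zx≢zy = contradiction
    (least-≤ D (s≤s z≤n) (smallerDistinguishingColoring G rigid x≢y z≢x z≢y zx≢zy)) 1+n≰n

theorem3p8 : (n : ℕ) (G : Graph n) (d t : ℕ) →
    IsDistinguishingNumber G d → IsDistinguishingThreshold G t →
    (t ≡ d ⇔ (Asymmetric G ⊎ IsComplete G ⊎ IsEmptyGraph G))
theorem3p8 n G d t D θ = mk⇔ (θ≡D⇒classified G D θ) classified⇒θ≡D
  where
  classified⇒θ≡D : Asymmetric G ⊎ IsComplete G ⊎ IsEmptyGraph G → t ≡ d
  classified⇒θ≡D (inj₁ asymmetric) = asymmetric⇒θ≡D G D θ asymmetric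
  classified⇒θ≡D (inj₂ (inj₁ complete)) = fullySymmetric⇒θ≡D G D θ (complete⇒fullySymmetric G complete)
  classified⇒θ≡D (inj₂ (inj₂ empty)) = fullySymmetric⇒θ≡D G D θ (empty⇒fullySymmetric G empty)
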